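{- Let $P$ and $Q$ be finite posets. If $P$ and $Q$ are LE-cactus, then the disjoint union $P+Q$ is LE-cactus.
   Context: For a finite poset $P$ with $n$ elements, a linear extension is a list $\ell=(p_1,\dots,p_n)$ of all elements of $P$ such that $p_a<_P p_b$ implies $a<b$; ${\mathcal{L}}(P)$ denotes the set of linear extensions. For $1\le i\le n-1$ the Bender--Knuth move $t_i:{\mathcal{L}}(P)\to{\mathcal{L}}(P)$ sends $(p_1,\dots,p_n)$ to the list with $p_i$ and $p_{i+1}$ swapped if $p_i$ and $p_{i+1}$ are incomparable in $P$, and fixes $\ell$ otherwise. The group $\mathcal{BK}_P$ is the subgroup of the symmetric group on ${\mathcal{L}}(P)$ generated by $t_1,\dots,t_{n-1}$; a relation $w=1$ (for a word $w$ in the $t_i$) holds in $\mathcal{BK}_P$ if the corresponding product of permutations is the identity. Define $q_m=t_1(t_2t_1)(t_3t_2t_1)\cdots(t_mt_{m-1}\cdots t_1)$ and $q_{jk}=q_{k-1}q_{k-j}q_{k-1}$. An $n$-element poset $P$ is LE-cactus if $(t_iq_{jk})^2=1$ holds in $\mathcal{BK}_P$ for all integers $i,j,k$ with $2\le i+1<j<k\le n$. The disjoint union $P+Q$ has underlying set the disjoint union of $P$ and $Q$, with $x\le y$ iff both lie in the same poset and are related there. -}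

module Defs where

open import Data.Nat using (ℕ; zero; suc; _∸_; _+_; _≤_; _<_)
open import Data.Fin using (Fin; splitAt; join)
open import Data.Fin.Properties using (join-splitAt)
import Data.Fin as F
open import Data.Vec using (Vec; []; _∷_; lookup)
open import Data.List using (List; []; _∷_; _++_)
open import Data.Bool using (Bool; true; false; if_then_else_; not)
open import Data.Sum using (_⊎_; inj₁; inj₂)
open import Data.Sum.Relation.Binary.Pointwise
  using (Pointwise; inj₁; inj₂; ⊎-reflexive; ⊎-transitive; ⊎-antisymmetric; ⊎-decidable; Pointwise-≡⇒≡; ≡⇒Pointwise-≡)
open import Data.Product using (_×_; _,_)
open import Relation.Nullary using (¬_; does)
open import Relation.Nullary.Decidable using (_⊎-dec_)
open import Relation.Binary using (Rel; Decidable; IsPartialOrder)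
open import Relation.Binary.PropositionalEquality using (_≡_; refl; cong; sym; trans)
open import Level using (0ℓ)

-- A finite poset, with underlying set Fin n (every finite poset is
-- isomorphic to one of this form) and a decidable partial order.
record FinPoset : Set₁ where
  field
    size           : ℕ
    _≼_            : Rel (Fin size) 0ℓ
    isPartialOrder : IsPartialOrder _≡_ _≼_
    _≼?_           : Decidable _≼_

open FinPoset public

Strict : (P : FinPoset) → Fin (size P) → Fin (size P) → Set
Strict P x y = (_≼_ P x y) × ¬ (x ≡ y)

record LinearExtension (P : FinPoset) (ℓ : Vec (Fin (size P)) (size P)) : Set where
  field
    distinct  : ∀ a b → lookup ℓ a ≡ lookup ℓ b → a ≡ b
    monotone  : ∀ a b → Strict P (lookup ℓ a) (lookup ℓ b) → F._<_ a b

comparable? : (P : FinPoset) → Fin (size P) → Fin (size P) → Bool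
comparable? P x y = does (_≼?_ P x y ⊎-dec _≼?_ P y x)

-- 0-indexed Bender–Knuth swap at positions i, i+1 (identity if out of range)
bk : (P : FinPoset) → ∀ {k} → ℕ → Vec (Fin (size P)) k → Vec (Fin (size P)) k
bk P zero    (x ∷ y ∷ xs) = if comparable? P x y then x ∷ y ∷ xs else y ∷ x ∷ xs
bk P (suc i) (x ∷ xs)     = x ∷ bk P i xs
bk P _       v            = v

-- The Bender–Knuth move t_i (1-indexed, 1 ≤ i ≤ n-1)
t : (P : FinPoset) → ℕ → Vec (Fin (size P)) (size P) → Vec (Fin (size P)) (size P)
t P zero    ℓ = ℓ
t P (suc i) ℓ = bk P i ℓ

-- A word in the generators t_i, given as a list of indices; the word
-- i₁ i₂ … i_r denotes the product t_{i₁} t_{i₂} ⋯ t_{i_r}.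
Word : Set
Word = List ℕ

act : (P : FinPoset) → Word → Vec (Fin (size P)) (size P) → Vec (Fin (size P)) (size P)
act P []      ℓ = ℓ
act P (i ∷ w) ℓ = t P i (act P w ℓ)

down : ℕ → Word
down zero    = []
down (suc m) = suc m ∷ down m

q : ℕ → Word
q zero    = []
q (suc m) = q m ++ down (suc m)

qjk : ℕ → ℕ → Word
qjk j k = q (k ∸ 1) ++ q (k ∸ j) ++ q (k ∸ 1)

-- the relation w = 1 holds in BK_P: the product is the identity permutation of L(P)
Holds : (P : FinPoset) → Word → Set
Holds P w = ∀ ℓ → LinearExtension P ℓ → act P w ℓ ≡ ℓ

cactusWord : ℕ → ℕ → ℕ → Word
cactusWord i j k = (i ∷ qjk j k) ++ (i ∷ qjk j k)

LE-cactus : FinPoset → Set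
LE-cactus P = ∀ i j k → 2 ≤ i + 1 → i + 1 < j → j < k → k ≤ size P →
              Holds P (cactusWord i j k)

-- Disjoint union P + Q on Fin (m + n): the first m elements form P, the rest Q.
module _ (P Q : FinPoset) where
  private
    m = size P
    n = size Q
    R : Rel (Fin m ⊎ Fin n) 0ℓ
    R = Pointwise (_≼_ P) (_≼_ Q)
    module PP = IsPartialOrder (isPartialOrder P)
    module QQ = IsPartialOrder (isPartialOrder Q)

  _+ᴾ_ : FinPoset
  _+ᴾ_ = record
    { size = m + n
    ; _≼_ = λ x y → R (splitAt m x) (splitAt m y)
    ; isPartialOrder = record
      { isPreorder = record
        { isEquivalence = Relation.Binary.PropositionalEquality.isEquivalence
        ; reflexive = λ { {x} refl → ⊎-reflexive PP.reflexive QQ.reflexive (≡⇒Pointwise-≡ {x = splitAt m {n} x} refl) }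
        ; trans = ⊎-transitive PP.trans QQ.trans
        }
      ; antisym = λ {x} {y} p r → trans (sym (join-splitAt m n x))
          (trans (cong (join m n) (Pointwise-≡⇒≡ (⊎-antisymmetric PP.antisym QQ.antisym p r)))
                 (join-splitAt m n y))
      }
    ; _≼?_ = λ x y → ⊎-decidable (_≼?_ P) (_≼?_ Q) (splitAt m x) (splitAt m y)
    }

module Submission where

-- Write a linear extension of P + Q as a list over Fin m ⊎ Fin n. Elements of P and of Q are
-- incomparable, so t_{p+1} swaps the entries p, p+1 of the shape (which positions hold elements
-- of P) unconditionally, and acts on the subsequence of P-elements as some move t_{p′+1} or not
-- at all. Hence q_m reverses the first m+1 letters of the shape and acts on the P-subsequence as
-- q_{m′}, where m′+1 is the number of P-elements among them; so q_{jk} reverses the shape between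
-- positions j and k and acts on the P-subsequence as q_{j′k′}. If i+1 < j, then t_i lives in the
-- prefix untouched by q_{jk}, and (t_i q_{jk})^2 restores the shape and acts on the P-subsequence
-- as (t_{i′} q_{j′k′})^2 with i′+1 < j′, which is trivial because P is LE-cactus. The same holds
-- for Q by symmetry, and a list over a disjoint union is determined by its shape and its two
-- subsequences.

open import Data.Bool using (Bool; true; false; if_then_else_)
open import Data.Bool.Properties using (∨-comm)
open import Data.Empty using (⊥-elim)
open import Data.Fin as F using (Fin; splitAt; join)
import Data.Fin.Properties as Fin
open import Data.List using (List; []; _∷_; _++_; length; map; reverse)
open import Data.List.Properties
  using ( ++-assoc; length-++; length-map; map-injective; reverse-++; reverse-involutive; length-reverse
        ; unfold-reverse; ∷-injectiveˡ; ∷-injectiveʳ )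
open import Data.List.Relation.Unary.All using (All; []; _∷_)
open import Data.List.Relation.Unary.AllPairs as AllPairs using (AllPairs; []; _∷_)
import Data.List.Relation.Unary.AllPairs.Properties as AllPairs
open import Data.Nat using (ℕ; zero; suc; pred; _+_; _∸_; _≤_; _<_; z≤n; s≤s; _≤?_)
open import Data.Nat.Properties
  using ( ≤-refl; ≤-trans; ≤-antisym; ≤-pred; <⇒≤; ≰⇒>; n≤1+n; m≤m+n; m≤n+m; +-suc; +-comm; +-identityʳ
        ; +-monoʳ-≤; +-cancelˡ-≡; +-cancelʳ-≤; m≤n⇒m∸n≡0; m+n∸m≡n; m≤n⇒∃[o]m+o≡n )
open import Data.Product using (_×_; _,_; proj₁; proj₂; ∃-syntax)
open import Data.Sum using (_⊎_; inj₁; inj₂; swap)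
open import Data.Sum.Properties using (inj₁-injective; inj₂-injective)
open import Data.Sum.Relation.Binary.Pointwise using (Pointwise; inj₁; inj₂)
open import Data.Vec using (Vec; []; _∷_; toList; fromList; lookup; cast)
open import Data.Vec.Properties using (toList∘fromList; toList-cast; toList-injective; cast-is-id; length-toList)
import Data.Vec.Relation.Unary.All.Properties as VecAll
open import Function using (_∘_)
open import Level using (0ℓ)
open import Relation.Binary using (Rel)
open import Relation.Binary.Definitions using (tri<; tri≈; tri>)
open import Relation.Binary.PropositionalEquality
  using (_≡_; refl; sym; trans; cong; cong₂; subst; subst₂; module ≡-Reasoning)
open import Relation.Nullary using (yes; no; does; ¬_)

open import Defs

+∸suc : ∀ a b → a + b ∸ suc a ≡ b ∸ 1
+∸suc zero    b = refl
+∸suc (suc a) b = +∸suc a b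

consMove : ℕ → ℕ
consMove zero    = zero
consMove (suc i) = suc (suc i)

-- Bender–Knuth moves on lists

module BenderKnuth {A : Set} (comparable : A → A → Bool) where

  bkᴸ : ℕ → List A → List A
  bkᴸ _       []           = []
  bkᴸ zero    (x ∷ [])     = x ∷ []
  bkᴸ zero    (x ∷ y ∷ xs) = if comparable x y then x ∷ y ∷ xs else y ∷ x ∷ xs
  bkᴸ (suc i) (x ∷ xs)     = x ∷ bkᴸ i xs

  tᴸ : ℕ → List A → List A
  tᴸ zero    xs = xs
  tᴸ (suc i) xs = bkᴸ i xs

  actᴸ : Word → List A → List A
  actᴸ []      xs = xs
  actᴸ (i ∷ w) xs = tᴸ i (actᴸ w xs)

  downᴸ : ℕ → List A → List A
  downᴸ m = actᴸ (down m)

  upᴸ : ℕ → List A → List A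
  upᴸ zero    xs = xs
  upᴸ (suc m) xs = upᴸ m (bkᴸ m xs)

  qᴸ : ℕ → List A → List A
  qᴸ zero    xs = xs
  qᴸ (suc m) xs = qᴸ m (downᴸ (suc m) xs)

  CactusFixed : List A → Set
  CactusFixed xs = ∀ i j k → 2 ≤ i + 1 → i + 1 < j → j < k → k ≤ length xs →
                   actᴸ (cactusWord i j k) xs ≡ xs

  actᴸ-++ : ∀ u w xs → actᴸ (u ++ w) xs ≡ actᴸ u (actᴸ w xs)
  actᴸ-++ []      w xs = refl
  actᴸ-++ (i ∷ u) w xs = cong (tᴸ i) (actᴸ-++ u w xs)

  actᴸ-q : ∀ m xs → actᴸ (q m) xs ≡ qᴸ m xs
  actᴸ-q zero    xs = refl
  actᴸ-q (suc m) xs = trans (actᴸ-++ (q m) (down (suc m)) xs) (actᴸ-q m (downᴸ (suc m) xs))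

  actᴸ-qjk : ∀ j k xs → actᴸ (qjk j k) xs ≡ qᴸ (k ∸ 1) (qᴸ (k ∸ j) (qᴸ (k ∸ 1) xs))
  actᴸ-qjk j k xs = begin
    actᴸ (q (k ∸ 1) ++ q (k ∸ j) ++ q (k ∸ 1)) xs        ≡⟨ actᴸ-++ (q (k ∸ 1)) _ xs ⟩
    actᴸ (q (k ∸ 1)) (actᴸ (q (k ∸ j) ++ q (k ∸ 1)) xs)  ≡⟨ actᴸ-q (k ∸ 1) _ ⟩
    qᴸ (k ∸ 1) (actᴸ (q (k ∸ j) ++ q (k ∸ 1)) xs)        ≡⟨ cong (qᴸ (k ∸ 1)) (actᴸ-++ (q (k ∸ j)) _ xs) ⟩
    qᴸ (k ∸ 1) (actᴸ (q (k ∸ j)) (actᴸ (q (k ∸ 1)) xs))  ≡⟨ cong (qᴸ (k ∸ 1)) (actᴸ-q (k ∸ j) _) ⟩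
    qᴸ (k ∸ 1) (qᴸ (k ∸ j) (actᴸ (q (k ∸ 1)) xs))        ≡⟨ cong (qᴸ (k ∸ 1) ∘ qᴸ (k ∸ j)) (actᴸ-q (k ∸ 1) xs) ⟩
    qᴸ (k ∸ 1) (qᴸ (k ∸ j) (qᴸ (k ∸ 1) xs))              ∎
    where open ≡-Reasoning

  bkᴸ-comm : ∀ r p xs → suc r < p → bkᴸ p (bkᴸ r xs) ≡ bkᴸ r (bkᴸ p xs)
  bkᴸ-comm r       p             []           _ = refl
  bkᴸ-comm zero    (suc (suc p)) (x ∷ [])     _ = refl
  bkᴸ-comm zero    (suc (suc p)) (x ∷ y ∷ xs) _ with comparable x y
  ... | true  = refl
  ... | false = refl
  bkᴸ-comm (suc r) (suc p)       (x ∷ xs)     (s≤s r<p) = cong (x ∷_) (bkᴸ-comm r p xs r<p)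
  bkᴸ-comm zero    (suc zero)    (x ∷ xs)     (s≤s ())

  downᴸ-bkᴸ-comm : ∀ m p xs → m < p → bkᴸ p (downᴸ m xs) ≡ downᴸ m (bkᴸ p xs)
  downᴸ-bkᴸ-comm zero    p xs m<p = refl
  downᴸ-bkᴸ-comm (suc m) p xs m<p =
    trans (bkᴸ-comm m p (downᴸ m xs) m<p) (cong (bkᴸ m) (downᴸ-bkᴸ-comm m p xs (≤-trans (n≤1+n _) m<p)))

  qᴸ-bkᴸ-comm : ∀ m p xs → m < p → bkᴸ p (qᴸ m xs) ≡ qᴸ m (bkᴸ p xs)
  qᴸ-bkᴸ-comm zero    p xs m<p = refl
  qᴸ-bkᴸ-comm (suc m) p xs m<p =
    trans (qᴸ-bkᴸ-comm m p (downᴸ (suc m) xs) (≤-trans (n≤1+n _) m<p))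
          (cong (qᴸ m) (downᴸ-bkᴸ-comm (suc m) p xs m<p))

  qᴸ-downᴸ : ∀ m xs → qᴸ m (downᴸ (suc m) xs) ≡ upᴸ (suc m) (qᴸ m xs)
  qᴸ-downᴸ zero    xs = refl
  qᴸ-downᴸ (suc m) xs = sym (begin
    upᴸ (suc m) (bkᴸ (suc m) (qᴸ m (downᴸ (suc m) xs)))  ≡⟨ cong (upᴸ (suc m)) (qᴸ-bkᴸ-comm m (suc m) _ ≤-refl) ⟩
    upᴸ (suc m) (qᴸ m (bkᴸ (suc m) (downᴸ (suc m) xs)))  ≡⟨ sym (qᴸ-downᴸ m _) ⟩
    qᴸ m (downᴸ (suc m) (downᴸ (suc (suc m)) xs))        ∎)
    where open ≡-Reasoning

  tᴸ-consMove : ∀ i x xs → tᴸ (consMove i) (x ∷ xs) ≡ x ∷ tᴸ i xs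
  tᴸ-consMove zero    x xs = refl
  tᴸ-consMove (suc i) x xs = refl

  qᴸ-unfold : ∀ n xs → qᴸ n xs ≡ qᴸ (n ∸ 1) (downᴸ n xs)
  qᴸ-unfold zero    xs = refl
  qᴸ-unfold (suc n) xs = refl

  downᴸ-cons₂ : ∀ m x y xs → downᴸ (suc m) (x ∷ y ∷ xs) ≡
                (if comparable x y then x ∷ downᴸ m (y ∷ xs) else y ∷ downᴸ m (x ∷ xs))
  downᴸ-cons₂ zero    x y xs = refl
  downᴸ-cons₂ (suc m) x y xs with comparable x y | downᴸ-cons₂ m x y xs
  ... | true  | eq = cong (bkᴸ (suc m)) eq
  ... | false | eq = cong (bkᴸ (suc m)) eq

  downᴸ-[x] : ∀ m x → downᴸ m (x ∷ []) ≡ x ∷ []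
  downᴸ-[x] zero          x = refl
  downᴸ-[x] (suc zero)    x = refl
  downᴸ-[x] (suc (suc m)) x = cong (bkᴸ (suc m)) (downᴸ-[x] (suc m) x)

  length-bkᴸ : ∀ p xs → length (bkᴸ p xs) ≡ length xs
  length-bkᴸ _       []           = refl
  length-bkᴸ zero    (x ∷ [])     = refl
  length-bkᴸ zero    (x ∷ y ∷ xs) with comparable x y
  ... | true  = refl
  ... | false = refl
  length-bkᴸ (suc p) (x ∷ xs)     = cong suc (length-bkᴸ p xs)

  bkᴸ-++ˡ : ∀ p xs ys → suc p < length xs → bkᴸ p (xs ++ ys) ≡ bkᴸ p xs ++ ys
  bkᴸ-++ˡ zero (x ∷ y ∷ xs) ys _ with comparable x y
  ... | true  = refl
  ... | false = refl
  bkᴸ-++ˡ (suc p) (x ∷ xs) ys (s≤s p<xs) = cong (x ∷_) (bkᴸ-++ˡ p xs ys p<xs)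
  bkᴸ-++ˡ zero    (x ∷ []) ys (s≤s ())

  module Involutive (comparable-sym : ∀ x y → comparable x y ≡ comparable y x) where

    bkᴸ-involutive : ∀ p xs → bkᴸ p (bkᴸ p xs) ≡ xs
    bkᴸ-involutive _       []           = refl
    bkᴸ-involutive zero    (x ∷ [])     = refl
    bkᴸ-involutive zero    (x ∷ y ∷ xs) with comparable x y in eq
    ... | true  rewrite eq = refl
    ... | false rewrite comparable-sym y x | eq = refl
    bkᴸ-involutive (suc p) (x ∷ xs)     = cong (x ∷_) (bkᴸ-involutive p xs)

    downᴸ-upᴸ : ∀ m xs → downᴸ m (upᴸ m xs) ≡ xs
    downᴸ-upᴸ zero    xs = refl
    downᴸ-upᴸ (suc m) xs = trans (cong (bkᴸ m) (downᴸ-upᴸ m (bkᴸ m xs))) (bkᴸ-involutive m xs)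

    qᴸ-involutive : ∀ m xs → qᴸ m (qᴸ m xs) ≡ xs
    qᴸ-involutive zero    xs = refl
    qᴸ-involutive (suc m) xs = begin
      qᴸ m (downᴸ (suc m) (qᴸ m (downᴸ (suc m) xs)))   ≡⟨ cong (qᴸ m ∘ downᴸ (suc m)) (qᴸ-downᴸ m xs) ⟩
      qᴸ m (downᴸ (suc m) (upᴸ (suc m) (qᴸ m xs)))     ≡⟨ cong (qᴸ m) (downᴸ-upᴸ (suc m) (qᴸ m xs)) ⟩
      qᴸ m (qᴸ m xs)                                   ≡⟨ qᴸ-involutive m xs ⟩
      xs                                               ∎
      where open ≡-Reasoning

    qjkᴸ-involutive : ∀ j k xs → actᴸ (qjk j k) (actᴸ (qjk j k) xs) ≡ xs
    qjkᴸ-involutive j k xs = begin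
      actᴸ (qjk j k) (actᴸ (qjk j k) xs)   ≡⟨ actᴸ-qjk j k _ ⟩
      Q (actᴸ (qjk j k) xs)                ≡⟨ cong Q (actᴸ-qjk j k xs) ⟩
      Q (Q xs)                             ≡⟨ cong (qᴸ a ∘ qᴸ b) (qᴸ-involutive a (qᴸ b (qᴸ a xs))) ⟩
      qᴸ a (qᴸ b (qᴸ b (qᴸ a xs)))         ≡⟨ cong (qᴸ a) (qᴸ-involutive b (qᴸ a xs)) ⟩
      qᴸ a (qᴸ a xs)                       ≡⟨ qᴸ-involutive a xs ⟩
      xs                                   ∎
      where
        open ≡-Reasoning
        a = k ∸ 1
        b = k ∸ j
        Q : List A → List A
        Q ys = qᴸ a (qᴸ b (qᴸ a ys))

    qjkᴸ-trivial : ∀ a b → b ≤ 1 → ∀ xs → actᴸ (qjk (suc a) (a + b)) xs ≡ xs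
    qjkᴸ-trivial a b b≤1 xs = begin
      actᴸ (qjk (suc a) (a + b)) xs                        ≡⟨ actᴸ-qjk (suc a) (a + b) xs ⟩
      qᴸ c (qᴸ (a + b ∸ suc a) (qᴸ c xs))                  ≡⟨ cong (λ z → qᴸ c (qᴸ z (qᴸ c xs))) k∸j≡0 ⟩
      qᴸ c (qᴸ c xs)                                       ≡⟨ qᴸ-involutive c xs ⟩
      xs                                                   ∎
      where
        open ≡-Reasoning
        c = a + b ∸ 1
        k∸j≡0 : a + b ∸ suc a ≡ 0
        k∸j≡0 = trans (+∸suc a b) (m≤n⇒m∸n≡0 b≤1)

    -- Outside the range of CactusFixed (i = 0, or b ≤ 1 so that q_{k-j} = 1) the word is a
    -- product of involutions.
    cactusFixed-relaxed : ∀ {xs} → CactusFixed xs → ∀ i a b → i ≡ 0 ⊎ i < a → a + b ≤ length xs →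
                          actᴸ (cactusWord i (suc a) (a + b)) xs ≡ xs
    cactusFixed-relaxed {xs} fixed zero a b _ _ =
      trans (actᴸ-++ (0 ∷ qjk (suc a) (a + b)) _ xs) (qjkᴸ-involutive (suc a) (a + b) xs)
    cactusFixed-relaxed {xs} fixed (suc r) a b (inj₂ i<a) k≤xs with 2 ≤? b
    ... | yes 2≤b = fixed (suc r) (suc a) (a + b) (s≤s (m≤n+m 1 r)) (s≤s (subst (_≤ a) (+-comm 1 (suc r)) i<a))
                          (subst (_≤ a + b) (+-comm a 2) (+-monoʳ-≤ a 2≤b)) k≤xs
    ... | no 2≰b = begin
      actᴸ ((suc r ∷ Q) ++ (suc r ∷ Q)) xs   ≡⟨ actᴸ-++ (suc r ∷ Q) (suc r ∷ Q) xs ⟩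
      bkᴸ r (actᴸ Q (bkᴸ r (actᴸ Q xs)))     ≡⟨ cong (λ z → bkᴸ r (actᴸ Q (bkᴸ r z))) (trivial xs) ⟩
      bkᴸ r (actᴸ Q (bkᴸ r xs))              ≡⟨ cong (bkᴸ r) (trivial (bkᴸ r xs)) ⟩
      bkᴸ r (bkᴸ r xs)                       ≡⟨ bkᴸ-involutive r xs ⟩
      xs                                     ∎
      where
        open ≡-Reasoning
        Q = qjk (suc a) (a + b)
        trivial : ∀ ys → actᴸ Q ys ≡ ys
        trivial = qjkᴸ-trivial a b (≤-pred (≰⇒> 2≰b))

module Intertwining {A A′ : Set} (c : A → A → Bool) (c′ : A′ → A′ → Bool) (G : List A → List A′)
       (G-bkᴸ : ∀ p xs → G (BenderKnuth.bkᴸ c p xs) ≡ BenderKnuth.bkᴸ c′ p (G xs)) where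
  private
    module B = BenderKnuth c
    module B′ = BenderKnuth c′

  G-downᴸ : ∀ m xs → G (B.downᴸ m xs) ≡ B′.downᴸ m (G xs)
  G-downᴸ zero    xs = refl
  G-downᴸ (suc m) xs = trans (G-bkᴸ m (B.downᴸ m xs)) (cong (B′.bkᴸ m) (G-downᴸ m xs))

  G-qᴸ : ∀ m xs → G (B.qᴸ m xs) ≡ B′.qᴸ m (G xs)
  G-qᴸ zero    xs = refl
  G-qᴸ (suc m) xs = trans (G-qᴸ m (B.downᴸ (suc m) xs)) (cong (B′.qᴸ m) (G-downᴸ (suc m) xs))

  G-actᴸ : ∀ w xs → G (B.actᴸ w xs) ≡ B′.actᴸ w (G xs)
  G-actᴸ []            xs = refl
  G-actᴸ (zero  ∷ w)   xs = G-actᴸ w xs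
  G-actᴸ (suc i ∷ w)   xs = trans (G-bkᴸ i (B.actᴸ w xs)) (cong (B′.bkᴸ i) (G-actᴸ w xs))

map-bkᴸ : ∀ {A A′ : Set} {c : A → A → Bool} {c′ : A′ → A′ → Bool} {g : A → A′} →
          (∀ x y → c′ (g x) (g y) ≡ c x y) →
          ∀ p xs → map g (BenderKnuth.bkᴸ c p xs) ≡ BenderKnuth.bkᴸ c′ p (map g xs)
map-bkᴸ         g-resp _       []           = refl
map-bkᴸ         g-resp zero    (x ∷ [])     = refl
map-bkᴸ {c = c} g-resp zero    (x ∷ y ∷ xs) rewrite g-resp x y with c x y
... | true  = refl
... | false = refl
map-bkᴸ {g = g} g-resp (suc p) (x ∷ xs)     = cong (g x ∷_) (map-bkᴸ g-resp p xs)

cactusFixed-map⁻ : ∀ {A A′ : Set} {c : A → A → Bool} {c′ : A′ → A′ → Bool} {g : A → A′} →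
                   (∀ {x y} → g x ≡ g y → x ≡ y) → (∀ x y → c′ (g x) (g y) ≡ c x y) →
                   ∀ xs → BenderKnuth.CactusFixed c′ (map g xs) → BenderKnuth.CactusFixed c xs
cactusFixed-map⁻ {c = c} {c′} {g} g-injective g-resp xs fixed i j k h₁ h₂ h₃ k≤xs =
  map-injective g-injective (trans (G-actᴸ (cactusWord i j k) xs)
    (fixed i j k h₁ h₂ h₃ (subst (k ≤_) (sym (length-map g xs)) k≤xs)))
  where open Intertwining c c′ (map g) (map-bkᴸ g-resp)

-- With every pair incomparable each t_{i+1} swaps positions i and i+1; this is how the shape of a
-- list over A ⊎ B moves.
module Free = BenderKnuth {Bool} (λ _ _ → false)

free-downᴸ : ∀ s X Y → Free.downᴸ (length X) (s ∷ X ++ Y) ≡ X ++ s ∷ Y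
free-downᴸ s []      Y = refl
free-downᴸ s (x ∷ X) Y = trans (Free.downᴸ-cons₂ (length X) s x (X ++ Y)) (cong (x ∷_) (free-downᴸ s X Y))

free-qᴸ : ∀ m X Y → length X ≡ suc m → Free.qᴸ m (X ++ Y) ≡ reverse X ++ Y
free-qᴸ zero    (x ∷ [])     Y refl = refl
free-qᴸ (suc m) (x ∷ y ∷ X) Y refl = begin
  Free.qᴸ m (Free.downᴸ (suc m) (x ∷ (y ∷ X) ++ Y))  ≡⟨ cong (Free.qᴸ m) (free-downᴸ x (y ∷ X) Y) ⟩
  Free.qᴸ m ((y ∷ X) ++ x ∷ Y)                       ≡⟨ free-qᴸ m (y ∷ X) (x ∷ Y) refl ⟩
  reverse (y ∷ X) ++ x ∷ Y                           ≡⟨ sym (++-assoc (reverse (y ∷ X)) (x ∷ []) Y) ⟩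
  (reverse (y ∷ X) ++ x ∷ []) ++ Y                   ≡⟨ cong (_++ Y) (sym (unfold-reverse x (y ∷ X))) ⟩
  reverse (x ∷ y ∷ X) ++ Y                           ∎
  where open ≡-Reasoning

trues : List Bool → ℕ
trues []          = 0
trues (true ∷ X)  = suc (trues X)
trues (false ∷ X) = trues X

trues-++ : ∀ X Y → trues (X ++ Y) ≡ trues X + trues Y
trues-++ []          Y = refl
trues-++ (true ∷ X)  Y = cong suc (trues-++ X Y)
trues-++ (false ∷ X) Y = trues-++ X Y

trues-reverse : ∀ X → trues (reverse X) ≡ trues X
trues-reverse []      = refl
trues-reverse (s ∷ X) = begin
  trues (reverse (s ∷ X))             ≡⟨ cong trues (unfold-reverse s X) ⟩
  trues (reverse X ++ s ∷ [])         ≡⟨ trues-++ (reverse X) (s ∷ []) ⟩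
  trues (reverse X) + trues (s ∷ [])  ≡⟨ cong (_+ trues (s ∷ [])) (trues-reverse X) ⟩
  trues X + trues (s ∷ [])            ≡⟨ +-[s] s ⟩
  trues (s ∷ X)                       ∎
  where
    open ≡-Reasoning
    +-[s] : ∀ s → trues X + trues (s ∷ []) ≡ trues (s ∷ X)
    +-[s] true  = +-comm (trues X) 1
    +-[s] false = +-identityʳ (trues X)

trues-bkᴸ : ∀ p X → trues (Free.bkᴸ p X) ≡ trues X
trues-bkᴸ _       []                  = refl
trues-bkᴸ zero    (s ∷ [])            = refl
trues-bkᴸ zero    (true ∷ true ∷ X)   = refl
trues-bkᴸ zero    (true ∷ false ∷ X)  = refl
trues-bkᴸ zero    (false ∷ true ∷ X)  = refl
trues-bkᴸ zero    (false ∷ false ∷ X) = refl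
trues-bkᴸ (suc p) (true ∷ X)          = cong suc (trues-bkᴸ p X)
trues-bkᴸ (suc p) (false ∷ X)         = trues-bkᴸ p X

-- On a list of shape X, t_{p+1} acts on the subsequence of lefts as t_(leftMove p X); the junk
-- index 0 stands for no move, since t_0 is the identity.
leftMove : ℕ → List Bool → ℕ
leftMove zero    (true ∷ true ∷ _) = 1
leftMove (suc p) (true ∷ X)        = consMove (leftMove p X)
leftMove (suc p) (false ∷ X)       = leftMove p X
leftMove _       _                 = 0

leftMove-++ˡ : ∀ p X Y → suc p < length X → leftMove p (X ++ Y) ≡ leftMove p X
leftMove-++ˡ zero    (true ∷ true ∷ X)  Y _ = refl
leftMove-++ˡ zero    (true ∷ false ∷ X) Y _ = refl
leftMove-++ˡ zero    (false ∷ _ ∷ X)    Y _ = refl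
leftMove-++ˡ zero    (_ ∷ [])           Y (s≤s ())
leftMove-++ˡ (suc p) (true ∷ X)         Y (s≤s p<X) = cong consMove (leftMove-++ˡ p X Y p<X)
leftMove-++ˡ (suc p) (false ∷ X)        Y (s≤s p<X) = leftMove-++ˡ p X Y p<X

leftMove-bkᴸ : ∀ p X → leftMove p (Free.bkᴸ p X) ≡ leftMove p X
leftMove-bkᴸ _       []                  = refl
leftMove-bkᴸ zero    (s ∷ [])            = refl
leftMove-bkᴸ zero    (true ∷ true ∷ X)   = refl
leftMove-bkᴸ zero    (true ∷ false ∷ X)  = refl
leftMove-bkᴸ zero    (false ∷ true ∷ X)  = refl
leftMove-bkᴸ zero    (false ∷ false ∷ X) = refl
leftMove-bkᴸ (suc p) (true ∷ X)          = cong consMove (leftMove-bkᴸ p X)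
leftMove-bkᴸ (suc p) (false ∷ X)         = leftMove-bkᴸ p X

leftMove-bound : ∀ p X → leftMove p X ≡ 0 ⊎ leftMove p X < trues X
leftMove-bound zero    (true ∷ true ∷ X)  = inj₂ (s≤s (s≤s z≤n))
leftMove-bound zero    (true ∷ false ∷ X) = inj₁ refl
leftMove-bound zero    (true ∷ [])        = inj₁ refl
leftMove-bound zero    (false ∷ X)        = inj₁ refl
leftMove-bound zero    []                 = inj₁ refl
leftMove-bound (suc p) []                 = inj₁ refl
leftMove-bound (suc p) (false ∷ X)        = leftMove-bound p X
leftMove-bound (suc p) (true ∷ X) with leftMove p X | leftMove-bound p X
... | zero  | _        = inj₁ refl
... | suc i | inj₂ i<X = inj₂ (s≤s i<X)

split₃ : ∀ {X : Set} a b (xs : List X) → a + b ≤ length xs →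
         ∃[ U ] ∃[ V ] ∃[ W ] xs ≡ U ++ V ++ W × length U ≡ a × length V ≡ b
split₃ zero    zero    xs       _         = [] , [] , xs , refl , refl , refl
split₃ zero    (suc b) (x ∷ xs) (s≤s b≤xs) with split₃ zero b xs b≤xs
... | [] , V , W , refl , _ , |V| = [] , x ∷ V , W , refl , refl , cong suc |V|
... | _ ∷ _ , _ , _ , _ , () , _
split₃ (suc a) b       (x ∷ xs) (s≤s ≤xs) with split₃ a b xs ≤xs
... | U , V , W , refl , |U| , |V| = x ∷ U , V , W , refl , cong suc |U| , |V|

-- Lists over a disjoint union

module _ {A B : Set} where

  isLeft : A ⊎ B → Bool
  isLeft (inj₁ _) = true
  isLeft (inj₂ _) = false

  shape : List (A ⊎ B) → List Bool
  shape = map isLeft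

  lefts : List (A ⊎ B) → List A
  lefts []            = []
  lefts (inj₁ a ∷ xs) = a ∷ lefts xs
  lefts (inj₂ _ ∷ xs) = lefts xs

  rights : List (A ⊎ B) → List B
  rights []            = []
  rights (inj₁ _ ∷ xs) = rights xs
  rights (inj₂ b ∷ xs) = b ∷ rights xs

  length-lefts : ∀ xs → length (lefts xs) ≡ trues (shape xs)
  length-lefts []            = refl
  length-lefts (inj₁ _ ∷ xs) = cong suc (length-lefts xs)
  length-lefts (inj₂ _ ∷ xs) = length-lefts xs

  shape-lefts-rights-injective : ∀ xs ys → shape xs ≡ shape ys → lefts xs ≡ lefts ys → rights xs ≡ rights ys → xs ≡ ys
  shape-lefts-rights-injective []            []            _ _ _ = refl
  shape-lefts-rights-injective (inj₁ a ∷ xs) (inj₁ _ ∷ ys) s l r =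
    cong₂ _∷_ (cong inj₁ (∷-injectiveˡ l)) (shape-lefts-rights-injective xs ys (∷-injectiveʳ s) (∷-injectiveʳ l) r)
  shape-lefts-rights-injective (inj₂ b ∷ xs) (inj₂ _ ∷ ys) s l r =
    cong₂ _∷_ (cong inj₂ (∷-injectiveˡ r)) (shape-lefts-rights-injective xs ys (∷-injectiveʳ s) l (∷-injectiveʳ r))
  shape-lefts-rights-injective (inj₁ _ ∷ xs) (inj₂ _ ∷ ys) () _ _
  shape-lefts-rights-injective (inj₂ _ ∷ xs) (inj₁ _ ∷ ys) () _ _

  trues≤length-lefts : ∀ xs X Y Z → shape xs ≡ X ++ Y ++ Z → trues X + trues Y ≤ length (lefts xs)
  trues≤length-lefts xs X Y Z e = subst (trues X + trues Y ≤_) (sym (begin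
    length (lefts xs)                    ≡⟨ length-lefts xs ⟩
    trues (shape xs)                     ≡⟨ cong trues e ⟩
    trues (X ++ Y ++ Z)                  ≡⟨ trues-++ X (Y ++ Z) ⟩
    trues X + trues (Y ++ Z)             ≡⟨ cong (trues X +_) (trues-++ Y Z) ⟩
    trues X + (trues Y + trues Z)        ∎))
    (+-monoʳ-≤ (trues X) (m≤m+n (trues Y) (trues Z)))
    where open ≡-Reasoning

  length-lefts-rights : ∀ xs → length (lefts xs) + length (rights xs) ≡ length xs
  length-lefts-rights []            = refl
  length-lefts-rights (inj₁ _ ∷ xs) = cong suc (length-lefts-rights xs)
  length-lefts-rights (inj₂ _ ∷ xs) = trans (+-suc (length (lefts xs)) _) (cong suc (length-lefts-rights xs))

  lefts-allPairs : ∀ {R : Rel (A ⊎ B) 0ℓ} {Rₗ : Rel A 0ℓ} → (∀ {a a′} → R (inj₁ a) (inj₁ a′) → Rₗ a a′) →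
                   ∀ {xs} → AllPairs R xs → AllPairs Rₗ (lefts xs)
  lefts-allPairs R⇒Rₗ {[]}          []       = []
  lefts-allPairs {R} {Rₗ} R⇒Rₗ {inj₁ a ∷ xs} (h ∷ hs) = lefts-All h ∷ lefts-allPairs R⇒Rₗ hs
    where
      lefts-All : ∀ {ys} → All (R (inj₁ a)) ys → All (Rₗ a) (lefts ys)
      lefts-All {[]}          []       = []
      lefts-All {inj₁ _ ∷ ys} (r ∷ rs) = R⇒Rₗ r ∷ lefts-All rs
      lefts-All {inj₂ _ ∷ ys} (_ ∷ rs) = lefts-All rs
  lefts-allPairs R⇒Rₗ {inj₂ _ ∷ xs} (_ ∷ hs) = lefts-allPairs R⇒Rₗ hs

  rights-allPairs : ∀ {R : Rel (A ⊎ B) 0ℓ} {Rᵣ : Rel B 0ℓ} → (∀ {b b′} → R (inj₂ b) (inj₂ b′) → Rᵣ b b′) →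
                    ∀ {xs} → AllPairs R xs → AllPairs Rᵣ (rights xs)
  rights-allPairs R⇒Rᵣ {[]}          []       = []
  rights-allPairs {R} {Rᵣ} R⇒Rᵣ {inj₂ b ∷ xs} (h ∷ hs) = rights-All h ∷ rights-allPairs R⇒Rᵣ hs
    where
      rights-All : ∀ {ys} → All (R (inj₂ b)) ys → All (Rᵣ b) (rights ys)
      rights-All {[]}          []       = []
      rights-All {inj₂ _ ∷ ys} (r ∷ rs) = R⇒Rᵣ r ∷ rights-All rs
      rights-All {inj₁ _ ∷ ys} (_ ∷ rs) = rights-All rs
  rights-allPairs R⇒Rᵣ {inj₁ _ ∷ xs} (_ ∷ hs) = rights-allPairs R⇒Rᵣ hs

lefts-swap : ∀ {A B : Set} (xs : List (A ⊎ B)) → lefts (map swap xs) ≡ rights xs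
lefts-swap []            = refl
lefts-swap (inj₁ _ ∷ xs) = lefts-swap xs
lefts-swap (inj₂ b ∷ xs) = cong (b ∷_) (lefts-swap xs)

module SumLists {A B : Set} (c₁ : A → A → Bool) (c₂ : B → B → Bool) where

  comparable⊎ : A ⊎ B → A ⊎ B → Bool
  comparable⊎ (inj₁ a) (inj₁ a′) = c₁ a a′
  comparable⊎ (inj₂ b) (inj₂ b′) = c₂ b b′
  comparable⊎ _        _         = false

  open BenderKnuth comparable⊎ public
  module L = BenderKnuth c₁

  shape-bkᴸ : ∀ p xs → shape (bkᴸ p xs) ≡ Free.bkᴸ p (shape xs)
  shape-bkᴸ _       []       = refl
  shape-bkᴸ zero    (x ∷ []) = refl
  shape-bkᴸ zero (inj₁ a ∷ inj₁ a′ ∷ xs) with c₁ a a′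
  ... | true  = refl
  ... | false = refl
  shape-bkᴸ zero (inj₂ b ∷ inj₂ b′ ∷ xs) with c₂ b b′
  ... | true  = refl
  ... | false = refl
  shape-bkᴸ zero    (inj₁ _ ∷ inj₂ _ ∷ xs) = refl
  shape-bkᴸ zero    (inj₂ _ ∷ inj₁ _ ∷ xs) = refl
  shape-bkᴸ (suc p) (x ∷ xs) = cong (isLeft x ∷_) (shape-bkᴸ p xs)

  module Shape = Intertwining comparable⊎ (λ _ _ → false) shape shape-bkᴸ

  lefts-downᴸ-inj₁ : ∀ {m} a r T U → shape r ≡ T ++ U → length T ≡ m →
                     lefts (downᴸ m (inj₁ a ∷ r)) ≡ L.downᴸ (trues T) (a ∷ lefts r)
  lefts-downᴸ-inj₁ a r [] U e refl = refl
  lefts-downᴸ-inj₁ a (inj₂ b ∷ r) (false ∷ T) U e refl =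
    trans (cong lefts (downᴸ-cons₂ (length T) (inj₁ a) (inj₂ b) r)) (lefts-downᴸ-inj₁ a r T U (∷-injectiveʳ e) refl)
  lefts-downᴸ-inj₁ a (inj₁ a′ ∷ r) (true ∷ T) U e refl
    rewrite downᴸ-cons₂ (length T) (inj₁ a) (inj₁ a′) r | L.downᴸ-cons₂ (trues T) a a′ (lefts r) with c₁ a a′
  ... | true  = cong (a ∷_) (lefts-downᴸ-inj₁ a′ r T U (∷-injectiveʳ e) refl)
  ... | false = cong (a′ ∷_) (lefts-downᴸ-inj₁ a r T U (∷-injectiveʳ e) refl)
  lefts-downᴸ-inj₁ a (inj₁ _ ∷ r) (false ∷ T) U () refl
  lefts-downᴸ-inj₁ a (inj₂ _ ∷ r) (true ∷ T)  U () refl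

  lefts-downᴸ-inj₂ : ∀ m b r → lefts (downᴸ m (inj₂ b ∷ r)) ≡ lefts r
  lefts-downᴸ-inj₂ zero    b r            = refl
  lefts-downᴸ-inj₂ (suc m) b []           = cong lefts (downᴸ-[x] (suc m) (inj₂ b))
  lefts-downᴸ-inj₂ (suc m) b (inj₁ a ∷ r) =
    trans (cong lefts (downᴸ-cons₂ m (inj₂ b) (inj₁ a) r)) (cong (a ∷_) (lefts-downᴸ-inj₂ m b r))
  lefts-downᴸ-inj₂ (suc m) b (inj₂ b′ ∷ r) rewrite downᴸ-cons₂ m (inj₂ b) (inj₂ b′) r with c₂ b b′
  ... | true  = lefts-downᴸ-inj₂ m b′ r
  ... | false = lefts-downᴸ-inj₂ m b r

  shape-qᴸ : ∀ m xs T U → shape xs ≡ T ++ U → length T ≡ suc m → shape (qᴸ m xs) ≡ reverse T ++ U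
  shape-qᴸ m xs T U e l = trans (Shape.G-qᴸ m xs) (trans (cong (Free.qᴸ m) e) (free-qᴸ m T U l))

  lefts-qᴸ : ∀ m xs T U → shape xs ≡ T ++ U → length T ≡ suc m →
             lefts (qᴸ m xs) ≡ L.qᴸ (trues T ∸ 1) (lefts xs)
  lefts-qᴸ zero    xs      (true ∷ [])  U _ _ = refl
  lefts-qᴸ zero    xs      (false ∷ []) U _ _ = refl
  lefts-qᴸ (suc m) (x ∷ r) (s ∷ T)      U e l = begin
    lefts (qᴸ m (downᴸ (suc m) (x ∷ r)))                ≡⟨ lefts-qᴸ m _ T (s ∷ U) shape-down |T| ⟩
    L.qᴸ (trues T ∸ 1) (lefts (downᴸ (suc m) (x ∷ r)))  ≡⟨ step x s (∷-injectiveˡ e) ⟩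
    L.qᴸ (trues (s ∷ T) ∸ 1) (lefts (x ∷ r))            ∎
    where
      open ≡-Reasoning
      |T| : length T ≡ suc m
      |T| = cong pred l
      shape-r : shape r ≡ T ++ U
      shape-r = ∷-injectiveʳ e
      shape-down : shape (downᴸ (suc m) (x ∷ r)) ≡ T ++ s ∷ U
      shape-down = begin
        shape (downᴸ (suc m) (x ∷ r))              ≡⟨ Shape.G-downᴸ (suc m) (x ∷ r) ⟩
        Free.downᴸ (suc m) (isLeft x ∷ shape r)    ≡⟨ cong (Free.downᴸ (suc m)) e ⟩
        Free.downᴸ (suc m) (s ∷ T ++ U)            ≡⟨ cong (λ n → Free.downᴸ n (s ∷ T ++ U)) (sym |T|) ⟩
        Free.downᴸ (length T) (s ∷ T ++ U)         ≡⟨ free-downᴸ s T U ⟩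
        T ++ s ∷ U                                 ∎
      step : ∀ x s → isLeft x ≡ s →
             L.qᴸ (trues T ∸ 1) (lefts (downᴸ (suc m) (x ∷ r))) ≡ L.qᴸ (trues (s ∷ T) ∸ 1) (lefts (x ∷ r))
      step (inj₁ a) true refl = begin
        L.qᴸ (trues T ∸ 1) (lefts (downᴸ (suc m) (inj₁ a ∷ r)))
          ≡⟨ cong (L.qᴸ (trues T ∸ 1)) (lefts-downᴸ-inj₁ a r T U shape-r |T|) ⟩
        L.qᴸ (trues T ∸ 1) (L.downᴸ (trues T) (a ∷ lefts r))
          ≡⟨ sym (L.qᴸ-unfold (trues T) _) ⟩
        L.qᴸ (trues T) (a ∷ lefts r)
          ∎
      step (inj₂ b) false refl = cong (L.qᴸ (trues T ∸ 1)) (lefts-downᴸ-inj₂ (suc m) b r)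

  lefts-bkᴸ : ∀ p xs → lefts (bkᴸ p xs) ≡ L.tᴸ (leftMove p (shape xs)) (lefts xs)
  lefts-bkᴸ zero    []                     = refl
  lefts-bkᴸ (suc p) []                     = refl
  lefts-bkᴸ zero    (inj₁ _ ∷ [])          = refl
  lefts-bkᴸ zero    (inj₂ _ ∷ [])          = refl
  lefts-bkᴸ zero (inj₁ a ∷ inj₁ a′ ∷ xs) with c₁ a a′
  ... | true  = refl
  ... | false = refl
  lefts-bkᴸ zero (inj₂ b ∷ inj₂ b′ ∷ xs) with c₂ b b′
  ... | true  = refl
  ... | false = refl
  lefts-bkᴸ zero    (inj₁ _ ∷ inj₂ _ ∷ xs) = refl
  lefts-bkᴸ zero    (inj₂ _ ∷ inj₁ _ ∷ xs) = refl
  lefts-bkᴸ (suc p) (inj₁ a ∷ xs) =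
    trans (cong (a ∷_) (lefts-bkᴸ p xs)) (sym (L.tᴸ-consMove (leftMove p (shape xs)) a (lefts xs)))
  lefts-bkᴸ (suc p) (inj₂ _ ∷ xs) = lefts-bkᴸ p xs

  module _ (a b : ℕ) (xs : List (A ⊎ B)) (X Y Z : List Bool)
           (e : shape xs ≡ X ++ Y ++ Z) (|X| : length X ≡ a) (|Y| : length Y ≡ suc b) where
    private
      K = a + b
      x₁ = qᴸ K xs
      x₂ = qᴸ b x₁
      x₃ = qᴸ K x₂
      act≡x₃ : actᴸ (qjk (suc a) (suc K)) xs ≡ x₃
      act≡x₃ = trans (actᴸ-qjk (suc a) (suc K) xs) (cong (λ n → qᴸ K (qᴸ n x₁)) (m+n∸m≡n a b))
      |XY| : length (X ++ Y) ≡ suc K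
      |XY| = trans (length-++ X) (trans (cong₂ _+_ |X| |Y|) (+-suc a b))
      |rY| : length (reverse Y) ≡ suc b
      |rY| = trans (length-reverse Y) |Y|
      |YrX| : length (Y ++ reverse X) ≡ suc K
      |YrX| = trans (length-++ Y) (trans (cong₂ _+_ |Y| (trans (length-reverse X) |X|)) (cong suc (+-comm b a)))
      shape₀ : shape xs ≡ (X ++ Y) ++ Z
      shape₀ = trans e (sym (++-assoc X Y Z))
      shape₁ : shape x₁ ≡ reverse Y ++ reverse X ++ Z
      shape₁ = begin
        shape x₁                        ≡⟨ shape-qᴸ K xs (X ++ Y) Z shape₀ |XY| ⟩
        reverse (X ++ Y) ++ Z           ≡⟨ cong (_++ Z) (reverse-++ X Y) ⟩
        (reverse Y ++ reverse X) ++ Z   ≡⟨ ++-assoc (reverse Y) (reverse X) Z ⟩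
        reverse Y ++ reverse X ++ Z     ∎
        where open ≡-Reasoning
      shape₂ : shape x₂ ≡ (Y ++ reverse X) ++ Z
      shape₂ = begin
        shape x₂                               ≡⟨ shape-qᴸ b x₁ (reverse Y) _ shape₁ |rY| ⟩
        reverse (reverse Y) ++ reverse X ++ Z  ≡⟨ cong (_++ reverse X ++ Z) (reverse-involutive Y) ⟩
        Y ++ reverse X ++ Z                    ≡⟨ sym (++-assoc Y (reverse X) Z) ⟩
        (Y ++ reverse X) ++ Z                  ∎
        where open ≡-Reasoning

    shape-qjk : shape (actᴸ (qjk (suc a) (suc (a + b))) xs) ≡ X ++ reverse Y ++ Z
    shape-qjk = begin
      shape (actᴸ (qjk (suc a) (suc K)) xs)    ≡⟨ cong shape act≡x₃ ⟩
      shape x₃                                 ≡⟨ shape-qᴸ K x₂ (Y ++ reverse X) Z shape₂ |YrX| ⟩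
      reverse (Y ++ reverse X) ++ Z            ≡⟨ cong (_++ Z) (reverse-++ Y (reverse X)) ⟩
      (reverse (reverse X) ++ reverse Y) ++ Z  ≡⟨ cong (λ W → (W ++ reverse Y) ++ Z) (reverse-involutive X) ⟩
      (X ++ reverse Y) ++ Z                    ≡⟨ ++-assoc X (reverse Y) Z ⟩
      X ++ reverse Y ++ Z                      ∎
      where open ≡-Reasoning

    lefts-qjk : lefts (actᴸ (qjk (suc a) (suc (a + b))) xs) ≡
                L.actᴸ (qjk (suc (trues X)) (trues X + trues Y)) (lefts xs)
    lefts-qjk = begin
      lefts (actᴸ (qjk (suc a) (suc K)) xs)
        ≡⟨ cong lefts act≡x₃ ⟩
      lefts x₃
        ≡⟨ lefts-qᴸ K x₂ (Y ++ reverse X) Z shape₂ |YrX| ⟩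
      L.qᴸ (trues (Y ++ reverse X) ∸ 1) (lefts x₂)
        ≡⟨ cong (λ n → L.qᴸ (n ∸ 1) (lefts x₂)) trues-YrX ⟩
      L.qᴸ k-1 (lefts x₂)
        ≡⟨ cong (L.qᴸ k-1) (lefts-qᴸ b x₁ (reverse Y) _ shape₁ |rY|) ⟩
      L.qᴸ k-1 (L.qᴸ (trues (reverse Y) ∸ 1) (lefts x₁))
        ≡⟨ cong (λ n → L.qᴸ k-1 (L.qᴸ (n ∸ 1) (lefts x₁))) (trues-reverse Y) ⟩
      L.qᴸ k-1 (L.qᴸ (cY ∸ 1) (lefts x₁))
        ≡⟨ cong (L.qᴸ k-1 ∘ L.qᴸ (cY ∸ 1)) (lefts-qᴸ K xs (X ++ Y) Z shape₀ |XY|) ⟩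
      L.qᴸ k-1 (L.qᴸ (cY ∸ 1) (L.qᴸ (trues (X ++ Y) ∸ 1) (lefts xs)))
        ≡⟨ cong (λ n → L.qᴸ k-1 (L.qᴸ (cY ∸ 1) (L.qᴸ (n ∸ 1) (lefts xs)))) (trues-++ X Y) ⟩
      L.qᴸ k-1 (L.qᴸ (cY ∸ 1) (L.qᴸ k-1 (lefts xs)))
        ≡⟨ cong (λ n → L.qᴸ k-1 (L.qᴸ n (L.qᴸ k-1 (lefts xs)))) (sym (+∸suc cX cY)) ⟩
      L.qᴸ k-1 (L.qᴸ (cX + cY ∸ suc cX) (L.qᴸ k-1 (lefts xs)))
        ≡⟨ sym (L.actᴸ-qjk (suc cX) (cX + cY) (lefts xs)) ⟩
      L.actᴸ (qjk (suc cX) (cX + cY)) (lefts xs)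
        ∎
      where
        open ≡-Reasoning
        cX = trues X
        cY = trues Y
        k-1 = cX + cY ∸ 1
        trues-YrX : trues (Y ++ reverse X) ≡ cX + cY
        trues-YrX = trans (trues-++ Y (reverse X)) (trans (cong (cY +_) (trues-reverse X)) (+-comm cY cX))

  tqjk-⊎ : ∀ p a b xs X Y Z → shape xs ≡ X ++ Y ++ Z → length X ≡ a → length Y ≡ suc b → suc p < a →
           shape (bkᴸ p (actᴸ (qjk (suc a) (suc (a + b))) xs)) ≡ Free.bkᴸ p X ++ reverse Y ++ Z ×
           lefts (bkᴸ p (actᴸ (qjk (suc a) (suc (a + b))) xs)) ≡
             L.tᴸ (leftMove p X) (L.actᴸ (qjk (suc (trues X)) (trues X + trues Y)) (lefts xs))
  tqjk-⊎ p a b xs X Y Z e |X| |Y| p<a = shape-result , lefts-result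
    where
      open ≡-Reasoning
      ys = actᴸ (qjk (suc a) (suc (a + b))) xs
      p<X : suc p < length X
      p<X = subst (suc p <_) (sym |X|) p<a
      shape-result : shape (bkᴸ p ys) ≡ Free.bkᴸ p X ++ reverse Y ++ Z
      shape-result = begin
        shape (bkᴸ p ys)                   ≡⟨ shape-bkᴸ p ys ⟩
        Free.bkᴸ p (shape ys)              ≡⟨ cong (Free.bkᴸ p) (shape-qjk a b xs X Y Z e |X| |Y|) ⟩
        Free.bkᴸ p (X ++ reverse Y ++ Z)   ≡⟨ Free.bkᴸ-++ˡ p X _ p<X ⟩
        Free.bkᴸ p X ++ reverse Y ++ Z     ∎
      lefts-result : lefts (bkᴸ p ys) ≡ L.tᴸ (leftMove p X) (L.actᴸ (qjk (suc (trues X)) (trues X + trues Y)) (lefts xs))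
      lefts-result = begin
        lefts (bkᴸ p ys)
          ≡⟨ lefts-bkᴸ p ys ⟩
        L.tᴸ (leftMove p (shape ys)) (lefts ys)
          ≡⟨ cong (λ W → L.tᴸ (leftMove p W) (lefts ys)) (shape-qjk a b xs X Y Z e |X| |Y|) ⟩
        L.tᴸ (leftMove p (X ++ reverse Y ++ Z)) (lefts ys)
          ≡⟨ cong (λ i → L.tᴸ i (lefts ys)) (leftMove-++ˡ p X _ p<X) ⟩
        L.tᴸ (leftMove p X) (lefts ys)
          ≡⟨ cong (L.tᴸ (leftMove p X)) (lefts-qjk a b xs X Y Z e |X| |Y|) ⟩
        L.tᴸ (leftMove p X) (L.actᴸ (qjk (suc (trues X)) (trues X + trues Y)) (lefts xs))
          ∎

  module _ (p a b : ℕ) (xs : List (A ⊎ B)) (X Y Z : List Bool)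
           (e : shape xs ≡ X ++ Y ++ Z) (|X| : length X ≡ a) (|Y| : length Y ≡ suc b) (p<a : suc p < a) where
    private
      w : Word
      w = suc p ∷ qjk (suc a) (suc (a + b))
      half₁ = tqjk-⊎ p a b xs X Y Z e |X| |Y| p<a
      half₂ = tqjk-⊎ p a b (actᴸ w xs) (Free.bkᴸ p X) (reverse Y) Z (proj₁ half₁)
                (trans (Free.length-bkᴸ p X) |X|) (trans (length-reverse Y) |Y|) p<a

    shape-cactusWord : shape (actᴸ (cactusWord (suc p) (suc a) (suc (a + b))) xs) ≡ shape xs
    shape-cactusWord = begin
      shape (actᴸ (w ++ w) xs)                                ≡⟨ cong shape (actᴸ-++ w w xs) ⟩
      shape (actᴸ w (actᴸ w xs))                              ≡⟨ proj₁ half₂ ⟩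
      Free.bkᴸ p (Free.bkᴸ p X) ++ reverse (reverse Y) ++ Z   ≡⟨ cong₂ (λ U V → U ++ V ++ Z)
                                                                   (Free.Involutive.bkᴸ-involutive (λ _ _ → refl) p X)
                                                                   (reverse-involutive Y) ⟩
      X ++ Y ++ Z                                             ≡⟨ sym e ⟩
      shape xs                                                ∎
      where open ≡-Reasoning

    lefts-cactusWord : (∀ x y → c₁ x y ≡ c₁ y x) → L.CactusFixed (lefts xs) →
                       lefts (actᴸ (cactusWord (suc p) (suc a) (suc (a + b))) xs) ≡ lefts xs
    lefts-cactusWord c₁-sym fixed = begin
      lefts (actᴸ (w ++ w) xs)                                ≡⟨ cong lefts (actᴸ-++ w w xs) ⟩
      lefts (actᴸ w (actᴸ w xs))                              ≡⟨ proj₂ half₂ ⟩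
      L.tᴸ (leftMove p X′) (L.actᴸ (qjk (suc (trues X′)) (trues X′ + trues (reverse Y))) (lefts (actᴸ w xs)))
        ≡⟨ cong₂ (λ j Q → L.tᴸ j (L.actᴸ Q (lefts (actᴸ w xs)))) (leftMove-bkᴸ p X)
                 (cong₂ (λ u v → qjk (suc u) (u + v)) (trues-bkᴸ p X) (trues-reverse Y)) ⟩
      L.tᴸ i (L.actᴸ Q (lefts (actᴸ w xs)))                   ≡⟨ cong (L.tᴸ i ∘ L.actᴸ Q) (proj₂ half₁) ⟩
      L.tᴸ i (L.actᴸ Q (L.tᴸ i (L.actᴸ Q (lefts xs))))        ≡⟨ sym (L.actᴸ-++ (i ∷ Q) (i ∷ Q) (lefts xs)) ⟩
      L.actᴸ (cactusWord i (suc (trues X)) (trues X + trues Y)) (lefts xs)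
        ≡⟨ L.Involutive.cactusFixed-relaxed c₁-sym fixed i (trues X) (trues Y) (leftMove-bound p X)
             (trues≤length-lefts xs X Y Z e) ⟩
      lefts xs                                                ∎
      where
        open ≡-Reasoning
        X′ = Free.bkᴸ p X
        i = leftMove p X
        Q = qjk (suc (trues X)) (trues X + trues Y)

  cactusFixed-shape-lefts : (∀ x y → c₁ x y ≡ c₁ y x) → ∀ xs → L.CactusFixed (lefts xs) →
                            ∀ i j k → 2 ≤ i + 1 → i + 1 < j → j < k → k ≤ length xs →
                            shape (actᴸ (cactusWord i j k) xs) ≡ shape xs ×
                            lefts (actᴸ (cactusWord i j k) xs) ≡ lefts xs
  cactusFixed-shape-lefts c₁-sym xs fixed zero    j       k (s≤s ()) _ _ _
  cactusFixed-shape-lefts c₁-sym xs fixed (suc p) (suc a) k _ i+1<j j<k k≤xs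
    with b , refl ← m≤n⇒∃[o]m+o≡n (<⇒≤ j<k)
    with X , Y , Z , e , |X| , |Y| ← split₃ a (suc b) (shape xs)
                                      (subst₂ _≤_ (sym (+-suc a b)) (sym (length-map isLeft xs)) k≤xs) =
    shape-cactusWord p a b xs X Y Z e |X| |Y| p<a , lefts-cactusWord p a b xs X Y Z e |X| |Y| p<a c₁-sym fixed
    where
      p<a : suc p < a
      p<a = subst (_≤ a) (cong suc (+-comm p 1)) (≤-pred i+1<j)

module _ {A B : Set} {c₁ : A → A → Bool} {c₂ : B → B → Bool}
         (c₁-sym : ∀ x y → c₁ x y ≡ c₁ y x) (c₂-sym : ∀ x y → c₂ x y ≡ c₂ y x) where
  open SumLists c₁ c₂
  private
    module S = SumLists c₂ c₁
    module R = BenderKnuth c₂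

  comparable⊎-swap : ∀ x y → S.comparable⊎ (swap x) (swap y) ≡ comparable⊎ x y
  comparable⊎-swap (inj₁ _) (inj₁ _) = refl
  comparable⊎-swap (inj₁ _) (inj₂ _) = refl
  comparable⊎-swap (inj₂ _) (inj₁ _) = refl
  comparable⊎-swap (inj₂ _) (inj₂ _) = refl

  module Swap = Intertwining comparable⊎ S.comparable⊎ (map swap) (map-bkᴸ comparable⊎-swap)

  cactusFixed-⊎ : ∀ xs → L.CactusFixed (lefts xs) → R.CactusFixed (rights xs) → CactusFixed xs
  cactusFixed-⊎ xs fixedₗ fixedᵣ i j k 2≤i+1 i+1<j j<k k≤xs =
    shape-lefts-rights-injective _ xs (proj₁ on-lefts) (proj₂ on-lefts) rights-fixed
    where
      open ≡-Reasoning
      w = cactusWord i j k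
      on-lefts = cactusFixed-shape-lefts c₁-sym xs fixedₗ i j k 2≤i+1 i+1<j j<k k≤xs
      fixedᵣ′ : R.CactusFixed (lefts (map swap xs))
      fixedᵣ′ rewrite lefts-swap xs = fixedᵣ
      on-rights = S.cactusFixed-shape-lefts c₂-sym (map swap xs) fixedᵣ′ i j k 2≤i+1 i+1<j j<k
                    (subst (k ≤_) (sym (length-map swap xs)) k≤xs)
      rights-fixed : rights (actᴸ w xs) ≡ rights xs
      rights-fixed = begin
        rights (actᴸ w xs)              ≡⟨ sym (lefts-swap (actᴸ w xs)) ⟩
        lefts (map swap (actᴸ w xs))    ≡⟨ cong lefts (Swap.G-actᴸ w xs) ⟩
        lefts (S.actᴸ w (map swap xs))  ≡⟨ proj₂ on-rights ⟩
        lefts (map swap xs)             ≡⟨ lefts-swap xs ⟩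
        rights xs                       ∎

-- Linear extensions as lists

comparable?-sym : (R : FinPoset) → ∀ x y → comparable? R x y ≡ comparable? R y x
comparable?-sym R x y = ∨-comm (does (_≼?_ R x y)) (does (_≼?_ R y x))

module _ {X : Set} {R : Rel X 0ℓ} where

  allPairs-lookup⁺ : ∀ {n} (v : Vec X n) → AllPairs R (toList v) → ∀ {a b} → a F.< b → R (lookup v a) (lookup v b)
  allPairs-lookup⁺ (x ∷ v) (h ∷ hs) {F.zero}  {F.suc b} _         = VecAll.lookup⁺ (VecAll.toList⁻ h) b
  allPairs-lookup⁺ (x ∷ v) (h ∷ hs) {F.suc a} {F.suc b} (s≤s a<b) = allPairs-lookup⁺ v hs a<b

  allPairs-lookup⁻ : ∀ {n} (v : Vec X n) → (∀ {a b} → a F.< b → R (lookup v a) (lookup v b)) → AllPairs R (toList v)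
  allPairs-lookup⁻ []      _ = []
  allPairs-lookup⁻ (x ∷ v) h =
    VecAll.toList⁺ (VecAll.lookup⁻ (λ b → h {F.zero} {F.suc b} (s≤s z≤n))) ∷ allPairs-lookup⁻ v (h ∘ s≤s)

allPairs-≢⇒lookup-injective : ∀ {X : Set} {n} (v : Vec X n) → AllPairs (λ x y → ¬ x ≡ y) (toList v) →
                              ∀ a b → lookup v a ≡ lookup v b → a ≡ b
allPairs-≢⇒lookup-injective v distinct a b eq with Fin.<-cmp a b
... | tri< a<b _ _ = ⊥-elim (allPairs-lookup⁺ v distinct a<b eq)
... | tri≈ _ a≡b _ = a≡b
... | tri> _ _ b<a = ⊥-elim (allPairs-lookup⁺ v distinct b<a (sym eq))

allPairs-≢⇒length≤ : ∀ {n} {xs : List (Fin n)} → AllPairs (λ x y → ¬ x ≡ y) xs → length xs ≤ n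
allPairs-≢⇒length≤ {xs = xs} distinct =
  Fin.injective⇒≤ (allPairs-≢⇒lookup-injective (fromList xs)
                     (subst (AllPairs _) (sym (toList∘fromList xs)) distinct) _ _)

MayPrecede : ∀ {X : Set} → Rel X 0ℓ → Rel X 0ℓ
MayPrecede _≤_ x y = ¬ x ≡ y × ¬ (y ≤ x × ¬ y ≡ x)

LinearExtensionᴸ : (R : FinPoset) → List (Fin (size R)) → Set
LinearExtensionᴸ R xs = length xs ≡ size R × AllPairs (MayPrecede (_≼_ R)) xs

module _ (R : FinPoset) where

  linearExtension⇒allPairs : ∀ {ℓ} → LinearExtension R ℓ → AllPairs (MayPrecede (_≼_ R)) (toList ℓ)
  linearExtension⇒allPairs {ℓ} le = allPairs-lookup⁻ ℓ λ {a} {b} a<b →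
    (λ eq → Fin.<-irrefl (distinct a b eq) a<b) , (λ b<a → Fin.<-asym a<b (monotone b a b<a))
    where open LinearExtension le

  allPairs⇒linearExtension : ∀ {ℓ} → AllPairs (MayPrecede (_≼_ R)) (toList ℓ) → LinearExtension R ℓ
  allPairs⇒linearExtension {ℓ} ordered = record
    { distinct = allPairs-≢⇒lookup-injective ℓ (AllPairs.map proj₁ ordered)
    ; monotone = monotone
    }
    where
      monotone : ∀ a b → Strict R (lookup ℓ a) (lookup ℓ b) → a F.< b
      monotone a b a<b with Fin.<-cmp a b
      ... | tri< a<b _ _ = a<b
      ... | tri≈ _ refl _ = ⊥-elim (proj₂ a<b refl)
      ... | tri> _ _ b<a = ⊥-elim (proj₂ (allPairs-lookup⁺ ℓ ordered b<a) a<b)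

  toList-bk : ∀ {n} i (v : Vec (Fin (size R)) n) → toList (bk R i v) ≡ BenderKnuth.bkᴸ (comparable? R) i (toList v)
  toList-bk zero    []          = refl
  toList-bk (suc i) []          = refl
  toList-bk zero    (x ∷ [])     = refl
  toList-bk zero    (x ∷ y ∷ v) with comparable? R x y
  ... | true  = refl
  ... | false = refl
  toList-bk (suc i) (x ∷ v)     = cong (x ∷_) (toList-bk i v)

  toList-act : ∀ w ℓ → toList (act R w ℓ) ≡ BenderKnuth.actᴸ (comparable? R) w (toList ℓ)
  toList-act []          ℓ = refl
  toList-act (zero ∷ w)  ℓ = toList-act w ℓ
  toList-act (suc i ∷ w) ℓ =
    trans (toList-bk i (act R w ℓ)) (cong (BenderKnuth.bkᴸ (comparable? R) i) (toList-act w ℓ))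

  LE-cactus⇒cactusFixed : LE-cactus R → ∀ {xs} → LinearExtensionᴸ R xs → BenderKnuth.CactusFixed (comparable? R) xs
  LE-cactus⇒cactusFixed cactus {xs} (|xs| , ordered) i j k h₁ h₂ h₃ k≤xs = begin
    actᴸ w xs                ≡⟨ cong (actᴸ w) (sym toList-ℓ) ⟩
    actᴸ w (toList ℓ)        ≡⟨ sym (toList-act w ℓ) ⟩
    toList (act R w ℓ)       ≡⟨ cong toList (cactus i j k h₁ h₂ h₃ (subst (k ≤_) |xs| k≤xs) ℓ le) ⟩
    toList ℓ                 ≡⟨ toList-ℓ ⟩
    xs                       ∎
    where
      open ≡-Reasoning
      open BenderKnuth (comparable? R) using (actᴸ)
      w = cactusWord i j k
      ℓ = cast |xs| (fromList xs)
      toList-ℓ : toList ℓ ≡ xs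
      toList-ℓ = trans (toList-cast |xs| (fromList xs)) (toList∘fromList xs)
      le : LinearExtension R ℓ
      le = allPairs⇒linearExtension (subst (AllPairs _) (sym toList-ℓ) ordered)

  cactusFixed⇒LE-cactus : (∀ ℓ → LinearExtension R ℓ → BenderKnuth.CactusFixed (comparable? R) (toList ℓ)) → LE-cactus R
  cactusFixed⇒LE-cactus fixed i j k h₁ h₂ h₃ k≤n ℓ le = trans (sym (cast-is-id refl (act R w ℓ)))
    (toList-injective refl (act R w ℓ) ℓ
      (trans (toList-act w ℓ) (fixed ℓ le i j k h₁ h₂ h₃ (subst (k ≤_) (sym (length-toList ℓ)) k≤n))))
    where w = cactusWord i j k

-- The disjoint union of posets

comparable?-+ᴾ : (P Q : FinPoset) → ∀ x y →
                 SumLists.comparable⊎ (comparable? P) (comparable? Q) (splitAt (size P) x) (splitAt (size P) y) ≡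
                 comparable? (P +ᴾ Q) x y
comparable?-+ᴾ P Q x y with splitAt (size P) x | splitAt (size P) y
... | inj₁ a | inj₁ b = refl
... | inj₁ a | inj₂ b = refl
... | inj₂ a | inj₁ b = refl
... | inj₂ a | inj₂ b = refl

mayPrecede-on : ∀ {X Y : Set} {_≤_ : Rel Y 0ℓ} {f : X → Y} → (∀ {x y} → f x ≡ f y → x ≡ y) →
                ∀ {x y} → MayPrecede (λ u v → f u ≤ f v) x y → MayPrecede _≤_ (f x) (f y)
mayPrecede-on f-injective (x≢y , ¬y<x) =
  (λ fx≡fy → x≢y (f-injective fx≡fy)) , λ (y≤x , fy≢fx) → ¬y<x (y≤x , λ y≡x → fy≢fx (cong _ y≡x))

module _ {X Y : Set} {R : Rel X 0ℓ} {S : Rel Y 0ℓ} where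

  mayPrecede-inj₁ : ∀ {x x′} → MayPrecede (Pointwise R S) (inj₁ x) (inj₁ x′) → MayPrecede R x x′
  mayPrecede-inj₁ (x≢x′ , ¬x′<x) =
    (λ eq → x≢x′ (cong inj₁ eq)) , λ (x′≤x , x′≢x) → ¬x′<x (inj₁ x′≤x , λ eq → x′≢x (inj₁-injective eq))

  mayPrecede-inj₂ : ∀ {y y′} → MayPrecede (Pointwise R S) (inj₂ y) (inj₂ y′) → MayPrecede S y y′
  mayPrecede-inj₂ (y≢y′ , ¬y′<y) =
    (λ eq → y≢y′ (cong inj₂ eq)) , λ (y′≤y , y′≢y) → ¬y′<y (inj₂ y′≤y , λ eq → y′≢y (inj₂-injective eq))

splitAt-injective : ∀ m {n} {x y : Fin (m + n)} → splitAt m x ≡ splitAt m y → x ≡ y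
splitAt-injective m {n} {x} {y} eq =
  trans (sym (Fin.join-splitAt m n x)) (trans (cong (join m n) eq) (Fin.join-splitAt m n y))

+-≤-≤⇒≡ : ∀ {l r m n} → l + r ≡ m + n → l ≤ m → r ≤ n → l ≡ m × r ≡ n
+-≤-≤⇒≡ {l} {r} {m} {n} eq l≤m r≤n = l≡m , +-cancelˡ-≡ m r n (trans (cong (_+ r) (sym l≡m)) eq)
  where
    l≡m : l ≡ m
    l≡m = ≤-antisym l≤m (+-cancelʳ-≤ n m l (subst (_≤ l + n) eq (+-monoʳ-≤ l r≤n)))

module _ (P Q : FinPoset) where

  +ᴾ-lefts-rights : ∀ {ℓ} → LinearExtension (P +ᴾ Q) ℓ →
                    LinearExtensionᴸ P (lefts (map (splitAt (size P)) (toList ℓ))) ×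
                    LinearExtensionᴸ Q (rights (map (splitAt (size P)) (toList ℓ)))
  +ᴾ-lefts-rights {ℓ} le = (proj₁ lengths , ordered-lefts) , (proj₂ lengths , ordered-rights)
    where
      xs = map (splitAt (size P)) (toList ℓ)
      ordered : AllPairs (MayPrecede (Pointwise (_≼_ P) (_≼_ Q))) xs
      ordered = AllPairs.map⁺ (AllPairs.map (mayPrecede-on {_≤_ = Pointwise (_≼_ P) (_≼_ Q)} (splitAt-injective (size P)))
                                            (linearExtension⇒allPairs (P +ᴾ Q) le))
      ordered-lefts = lefts-allPairs mayPrecede-inj₁ ordered
      ordered-rights = rights-allPairs mayPrecede-inj₂ ordered
      lengths = +-≤-≤⇒≡ (trans (length-lefts-rights xs) (trans (length-map _ (toList ℓ)) (length-toList ℓ)))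
                  (allPairs-≢⇒length≤ (AllPairs.map proj₁ ordered-lefts))
                  (allPairs-≢⇒length≤ (AllPairs.map proj₁ ordered-rights))

theorem3p17 : (P Q : FinPoset) → LE-cactus P → LE-cactus Q → LE-cactus (P +ᴾ Q)
theorem3p17 P Q cactusP cactusQ = cactusFixed⇒LE-cactus (P +ᴾ Q) fixed
  where
    fixed : ∀ ℓ → LinearExtension (P +ᴾ Q) ℓ → BenderKnuth.CactusFixed (comparable? (P +ᴾ Q)) (toList ℓ)
    fixed ℓ le = cactusFixed-map⁻ (splitAt-injective (size P)) (comparable?-+ᴾ P Q) (toList ℓ)
      (cactusFixed-⊎ (comparable?-sym P) (comparable?-sym Q) (map (splitAt (size P)) (toList ℓ))
         (LE-cactus⇒cactusFixed P cactusP (proj₁ (+ᴾ-lefts-rights P Q le)))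
         (LE-cactus⇒cactusFixed Q cactusQ (proj₂ (+ᴾ-lefts-rights P Q le))))
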